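{- Let $A$ be an arena, $\sigma : A$ a causal strategy, and $m, n_1, n_2 \in |\sigma|$. If $n_1 <_\sigma m$ and $n_2 <_\sigma m$ are both immediate (no event strictly in between) with $n_1 \neq n_2$, then $\mathrm{pol}(m) = +$.
   Context: An arena is an event structure with polarities and symmetry which is alternating, forestial (the events below a given event are totally ordered) and race-free. A causal strategy $\sigma : A$ has a display map $\partial_\sigma$ which is a map of event structures (locally injective on configurations), polarities imported from $A$, and is courteous: if $s_1<_\sigma s_2$ immediately and $\mathrm{pol}(s_1)=+$ or $\mathrm{pol}(s_2)=-$, then $\partial_\sigma(s_1)<_A\partial_\sigma(s_2)$ immediately; it is also receptive. -}

module Defs where

open import Data.Product using (Σ; ∃; ∃-syntax; _×_; _,_)
open import Data.Sum using (_⊎_)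
open import Data.List using (List)
open import Data.List.Membership.Propositional using (_∈_)
open import Relation.Binary.PropositionalEquality using (_≡_; _≢_)
open import Relation.Nullary using (¬_)

data Pol : Set where
  plus  : Pol
  minus : Pol

record EventStructure : Set₁ where
  field
    Ev        : Set
    _≤_       : Ev → Ev → Set
    ≤-refl    : ∀ {a} → a ≤ a
    ≤-trans   : ∀ {a b c} → a ≤ b → b ≤ c → a ≤ c
    ≤-antisym : ∀ {a b} → a ≤ b → b ≤ a → a ≡ b
    finite-history : ∀ e → ∃[ l ] (∀ {e'} → e' ≤ e → e' ∈ l)
    _#_       : Ev → Ev → Set
    #-irrefl  : ∀ {a} → ¬ (a # a)
    #-sym     : ∀ {a b} → a # b → b # a
    #-hered   : ∀ {a b c} → a # b → b ≤ c → a # c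

  _<_ : Ev → Ev → Set
  a < b = a ≤ b × a ≢ b

  _⋖_ : Ev → Ev → Set
  a ⋖ b = a < b × ¬ (∃[ c ] (a < c × c < b))

open EventStructure public

Subset : EventStructure → Set₁
Subset E = Ev E → Set

_⊆_ : ∀ {E} → Subset E → Subset E → Set
_⊆_ {E} x y = ∀ {a : Ev E} → x a → y a

record IsConfiguration (E : EventStructure) (x : Subset E) : Set where
  field
    down-closed   : ∀ {a b} → x b → _≤_ E a b → x a
    conflict-free : ∀ {a b} → x a → x b → ¬ (_#_ E a b)
    finite        : ∃[ l ] (∀ {a} → x a → a ∈ l)

_∪｛_｝ : ∀ {E} → Subset E → Ev E → Subset E
(x ∪｛ a ｝) e = x e ⊎ e ≡ a

_∪｛_,_｝ : ∀ {E} → Subset E → Ev E → Ev E → Subset E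
(x ∪｛ a , b ｝) e = x e ⊎ (e ≡ a ⊎ e ≡ b)

Extends : (E : EventStructure) → Subset E → Ev E → Set
Extends E x a = IsConfiguration E x × ¬ (x a) × IsConfiguration E (_∪｛_｝ {E} x a)

Image : ∀ {E E' : EventStructure} → (Ev E → Ev E') → Subset E → Subset E'
Image {E} f x b = ∃[ a ] (x a × f a ≡ b)

record Map (E E' : EventStructure) : Set₁ where
  field
    fun : Ev E → Ev E'
    preserves-config : ∀ {x} → IsConfiguration E x → IsConfiguration E' (Image {E} {E'} fun x)
    locally-injective : ∀ {x} → IsConfiguration E x →
                        ∀ {a b} → x a → x b → fun a ≡ fun b → a ≡ b

open Map public

-- Symmetries (isomorphism families). A partial bijection is given by its
-- graph θ : Ev → Ev → Set.

Rel : EventStructure → Set₁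
Rel E = Ev E → Ev E → Set

record IsBij (E : EventStructure) (θ : Rel E) (x y : Subset E) : Set where
  field
    dom  : ∀ {a b} → θ a b → x a
    cod  : ∀ {a b} → θ a b → y b
    tot  : ∀ {a} → x a → ∃[ b ] θ a b
    sur  : ∀ {b} → y b → ∃[ a ] θ a b
    func : ∀ {a b b'} → θ a b → θ a b' → b ≡ b'
    inj  : ∀ {a a' b} → θ a b → θ a' b → a ≡ a'

idRel : ∀ {E} → Subset E → Rel E
idRel x a b = x a × a ≡ b

invRel : ∀ {E} → Rel E → Rel E
invRel θ a b = θ b a

compRel : ∀ {E} → Rel E → Rel E → Rel E
compRel {E} θ φ a c = ∃[ b ] (θ a b × φ b c)

restrictRel : ∀ {E} → Rel E → Subset E → Rel E
restrictRel θ x a b = x a × θ a b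

_⊆ᴿ_ : ∀ {E} → Rel E → Rel E → Set
_⊆ᴿ_ {E} θ φ = ∀ {a b : Ev E} → θ a b → φ a b

record IsSymmetry (E : EventStructure) (S : Rel E → Set) : Set₁ where
  field
    bij     : ∀ {θ} → S θ → ∃[ x ] ∃[ y ] (IsConfiguration E x × IsConfiguration E y × IsBij E θ x y)
    ident   : ∀ {x} → IsConfiguration E x → S (idRel {E} x)
    inverse : ∀ {θ} → S θ → S (invRel {E} θ)
    compose : ∀ {θ φ x y z} → S θ → IsBij E θ x y → S φ → IsBij E φ y z → S (compRel {E} θ φ)
    restrict : ∀ {θ x y x'} → S θ → IsBij E θ x y →
               IsConfiguration E x' → _⊆_ {E} x' x →
               S (restrictRel {E} θ x')
    extend  : ∀ {θ x y x'} → S θ → IsBij E θ x y →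
              IsConfiguration E x' → _⊆_ {E} x x' →
              Σ (Rel E) λ θ' → Σ (Subset E) λ y' → (S θ' × IsBij E θ' x' y' × _⊆ᴿ_ {E} θ θ')

record Arena : Set₁ where
  field
    es       : EventStructure
    pol      : Ev es → Pol
    sym      : Rel es → Set
    isSym    : IsSymmetry es sym
    sym-pol  : ∀ {θ a b} → sym θ → θ a b → pol a ≡ pol b
    alternating : ∀ {a b} → _⋖_ es a b → pol a ≢ pol b
    forestial   : ∀ {a b e} → _≤_ es a e → _≤_ es b e → _≤_ es a b ⊎ _≤_ es b a
    race-free   : ∀ {x : Subset es} {a b : Ev es} → Extends es x a → Extends es x b → a ≢ b →
                  pol a ≢ pol b → IsConfiguration es (_∪｛_,_｝ {es} x a b)

open Arena public

record CausalStrategy (A : Arena) : Set₁ where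
  field
    σ : EventStructure
    ∂ : Map σ (es A)

  polσ : Ev σ → Pol
  polσ s = pol A (fun ∂ s)

  field
    courteous : ∀ {s₁ s₂} → _⋖_ σ s₁ s₂ → (polσ s₁ ≡ plus ⊎ polσ s₂ ≡ minus) →
                _⋖_ (es A) (fun ∂ s₁) (fun ∂ s₂)
    receptive : ∀ {x : Subset σ} {a : Ev (es A)} → IsConfiguration σ x →
                Extends (es A) (Image {σ} {es A} (fun ∂) x) a → pol A a ≡ minus →
                Σ (Ev σ) λ s → ((Extends σ x s × fun ∂ s ≡ a) ×
                        (∀ s' → Extends σ x s' → fun ∂ s' ≡ a → s' ≡ s))

open CausalStrategy public

{-# OPTIONS --safe #-}
module Submission where

-- If m were negative, courtesy would make ∂n₁ and ∂n₂ immediate predecessors of ∂m in A.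
-- Both lie in the configuration [m], so local injectivity keeps them distinct; but in a
-- forest the events below ∂m form a chain, and a chain has only one immediate predecessor
-- of its top.

open import Defs
open import Relation.Binary.PropositionalEquality using (_≡_; _≢_; refl; ≢-sym)
open import Data.Product using (_,_; proj₁)
open import Data.Sum using (inj₁; inj₂)
open import Relation.Nullary using (¬_)

history : (E : EventStructure) → Ev E → Subset E
history E m a = _≤_ E a m

history-isConfiguration : (E : EventStructure) (m : Ev E) → IsConfiguration E (history E m)
history-isConfiguration E m = record
  { down-closed   = λ b≤m a≤b → ≤-trans E a≤b b≤m
  ; conflict-free = λ a≤m b≤m a#b → #-irrefl E (#-hered E (#-sym E (#-hered E a#b b≤m)) a≤m)
  ; finite        = finite-history E m
  }

⋖-below-⋖-equal : (E : EventStructure) {a b c : Ev E} →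
                  _≤_ E a b → _⋖_ E a c → _⋖_ E b c → ¬ (a ≢ b)
⋖-below-⋖-equal E a≤b (_ , nothing-between) (b<c , _) a≢b =
  nothing-between (_ , (a≤b , a≢b) , b<c)

⋖-predecessor-unique : (A : Arena) {a b c : Ev (es A)} →
                       _⋖_ (es A) a c → _⋖_ (es A) b c → ¬ (a ≢ b)
⋖-predecessor-unique A a⋖c@((a≤c , _) , _) b⋖c@((b≤c , _) , _) a≢b
  with forestial A a≤c b≤c
... | inj₁ a≤b = ⋖-below-⋖-equal (es A) a≤b a⋖c b⋖c a≢b
... | inj₂ b≤a = ⋖-below-⋖-equal (es A) b≤a b⋖c a⋖c (≢-sym a≢b)

Map-injective-below : {E E' : EventStructure} (f : Map E E') {a b m : Ev E} →
                      _≤_ E a m → _≤_ E b m → a ≢ b → fun f a ≢ fun f b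
Map-injective-below {E} f {m = m} a≤m b≤m a≢b fa≡fb =
  a≢b (locally-injective f (history-isConfiguration E m) a≤m b≤m fa≡fb)

lemmaA6 : (A : Arena) (S : CausalStrategy A) (m n₁ n₂ : Ev (σ S)) →
          _⋖_ (σ S) n₁ m → _⋖_ (σ S) n₂ m → n₁ ≢ n₂ →
          polσ S m ≡ plus
lemmaA6 A S m n₁ n₂ n₁⋖m n₂⋖m n₁≢n₂ with polσ S m in pol-m
... | plus  = refl
... | minus with () ← ⋖-predecessor-unique A
                        (courteous S n₁⋖m (inj₂ pol-m))
                        (courteous S n₂⋖m (inj₂ pol-m))
                        (Map-injective-below (∂ S) (proj₁ (proj₁ n₁⋖m)) (proj₁ (proj₁ n₂⋖m)) n₁≢n₂)
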